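{- If $H$ is a $3$-uniform $2$-intersecting hypergraph with $\tau(H)=2$, then the edge set of $H$ consists of all $3$-element subsets of some $4$-element set (i.e. $H$ is, up to vertices in no edge, the complete $3$-uniform hypergraph on $4$ vertices).
   Context: A hypergraph is $r$-uniform if every edge has exactly $r$ vertices, and $2$-intersecting if any two distinct edges share at least two vertices. The covering number $\tau(H)$ is the minimum size of a set of vertices meeting every edge. Hypergraphs are finite and simple. -}

module Defs where

open import Data.Nat using (ℕ; _≤_)
open import Data.Fin.Subset using (Subset; ∣_∣; _∩_; Nonempty; _⊆_)
open import Data.List using (List)
open import Data.List.Membership.Propositional using (_∈_)
open import Data.Product using (Σ; _×_)
open import Relation.Binary.PropositionalEquality using (_≡_)
open import Relation.Nullary using (¬_)

-- A finite hypergraph on vertex set Fin n, given by its list of edges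
-- (each edge a subset of Fin n). The edge SET is {e | e ∈ edges}.
record Hypergraph (n : ℕ) : Set where
  constructor hyp
  field
    edges : List (Subset n)
open Hypergraph public

Uniform : ∀ {n} → ℕ → Hypergraph n → Set
Uniform r H = ∀ {e} → e ∈ edges H → ∣ e ∣ ≡ r

TwoIntersecting : ∀ {n} → Hypergraph n → Set
TwoIntersecting H =
  ∀ {e f} → e ∈ edges H → f ∈ edges H → ¬ (e ≡ f) → 2 ≤ ∣ e ∩ f ∣

IsCover : ∀ {n} → Hypergraph n → Subset n → Set
IsCover H C = ∀ {e} → e ∈ edges H → Nonempty (C ∩ e)

CoveringNumberIs : ∀ {n} → Hypergraph n → ℕ → Set
CoveringNumberIs H k =
  Σ (Subset _) (λ C → IsCover H C × ∣ C ∣ ≡ k)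
  × (∀ C → IsCover H C → k ≤ ∣ C ∣)

-- Take a vertex a of some edge and an edge f avoiding a (no single vertex is a cover), and let
-- S = f ∪ {a}. For edges e, f and x ∈ e ∖ f, the edge f contains the two other vertices of e,
-- so every edge through a lies in S, and for each v ∈ S some edge inside S avoids v; hence every
-- S - v is an edge. Conversely an edge g with a vertex x ∉ S would have g - x inside every S - v,
-- whose intersection is empty.
module Submission where

open import Defs
open import Data.Nat using (ℕ; suc; _≤_; _<_; s≤s; z≤n)
open import Data.Nat.Properties using (suc-injective; ≤-refl; ≤-reflexive; <⇒≱)
open import Data.Fin using (zero; suc; _≟_)
open import Data.Fin.Properties using (any?)
open import Data.Fin.Subset
  using (Subset; ∣_∣; _⊆_; _∩_; _∪_; _-_; ⁅_⁆; ⊥; Nonempty; inside; outside)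
  renaming (_∈_ to _∈ₛ_; _∉_ to _∉ₛ_)
open import Data.Fin.Subset.Properties
open import Data.Vec using (_∷_; here; there)
open import Data.List using (_∷_; [])
open import Data.List.Relation.Unary.Any using (here; there)
import Data.List.Relation.Unary.Any as Any
open import Data.List.Membership.Propositional using (_∈_; find; lose)
open import Data.Product using (Σ; ∃; _×_; _,_)
open import Data.Empty using (⊥-elim)
open import Data.Sum using (inj₁; inj₂)
open import Function using (_∘_)
open import Function.Bundles using (_⇔_; mk⇔)
open import Relation.Nullary using (¬_; yes; no; contradiction)
open import Relation.Nullary.Decidable using (decidable-stable; _×-dec_; ¬?)
open import Relation.Binary.PropositionalEquality using (_≡_; _≢_; refl; sym; trans; cong; subst)

private
  variable
    n k : ℕ

∣p∣≡1+∣p-x∣ : ∀ {p : Subset n} {x} → x ∈ₛ p → ∣ p ∣ ≡ suc ∣ p - x ∣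
∣p∣≡1+∣p-x∣ {p = _ ∷ p} here = cong suc (cong ∣_∣ (sym (p─⊥≡p p)))
∣p∣≡1+∣p-x∣ {p = inside ∷ p} (there x∈p) = cong suc (∣p∣≡1+∣p-x∣ x∈p)
∣p∣≡1+∣p-x∣ {p = outside ∷ p} (there x∈p) = ∣p∣≡1+∣p-x∣ x∈p

∣p∪⁅x⁆∣≡1+∣p∣ : ∀ {p : Subset n} {x} → x ∉ₛ p → ∣ p ∪ ⁅ x ⁆ ∣ ≡ suc ∣ p ∣
∣p∪⁅x⁆∣≡1+∣p∣ {p = inside ∷ p} {zero} x∉p = contradiction here x∉p
∣p∪⁅x⁆∣≡1+∣p∣ {p = outside ∷ p} {zero} _ = cong suc (cong ∣_∣ (∪-identityʳ p))
∣p∪⁅x⁆∣≡1+∣p∣ {p = inside ∷ p} {suc x} x∉p = cong suc (∣p∪⁅x⁆∣≡1+∣p∣ (x∉p ∘ there))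
∣p∪⁅x⁆∣≡1+∣p∣ {p = outside ∷ p} {suc x} x∉p = ∣p∪⁅x⁆∣≡1+∣p∣ (x∉p ∘ there)

∣p∣≡1+k⇒∣p-x∣≡k : ∀ {p : Subset n} {x} → x ∈ₛ p → ∣ p ∣ ≡ suc k → ∣ p - x ∣ ≡ k
∣p∣≡1+k⇒∣p-x∣≡k x∈p ∣p∣≡1+k = suc-injective (trans (sym (∣p∣≡1+∣p-x∣ x∈p)) ∣p∣≡1+k)

x∈p-y⇒x∈p : ∀ {p : Subset n} {x y} → x ∈ₛ p - y → x ∈ₛ p
x∈p-y⇒x∈p {p = p} {y = y} = p─q⊆p p ⁅ y ⁆

x∉p-x : ∀ {p : Subset n} x → x ∉ₛ p - x
x∉p-x {p = _ ∷ _} zero ()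
x∉p-x {p = _ ∷ p} (suc x) (there x∈p-x) = x∉p-x {p = p} x x∈p-x

x∈p-y⇒x≢y : ∀ {p : Subset n} {x y} → x ∈ₛ p - y → x ≢ y
x∈p-y⇒x≢y x∈p-x refl = x∉p-x _ x∈p-x

∣q∣<∣p∣⇒∃∈p∉q : ∀ {p q : Subset n} → ∣ q ∣ < ∣ p ∣ → ∃ λ x → x ∈ₛ p × x ∉ₛ q
∣q∣<∣p∣⇒∃∈p∉q {p = p} {q} ∣q∣<∣p∣ with any? (λ x → x ∈? p ×-dec ¬? (x ∈? q))
... | yes found = found
... | no none = contradiction (p⊆q⇒∣p∣≤∣q∣ p⊆q) (<⇒≱ ∣q∣<∣p∣)
  where
  p⊆q : p ⊆ q
  p⊆q {x} x∈p = decidable-stable (x ∈? q) (λ x∉q → none (x , x∈p , x∉q))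

∣p∣≡1+k⇒nonempty : ∀ {p : Subset n} → ∣ p ∣ ≡ suc k → Nonempty p
∣p∣≡1+k⇒nonempty {n} {p = p} ∣p∣≡1+k =
  let x , x∈p , _ = ∣q∣<∣p∣⇒∃∈p∉q {q = ⊥} ∣⊥∣<∣p∣ in x , x∈p
  where
  ∣⊥∣<∣p∣ : ∣ ⊥ {n} ∣ < ∣ p ∣
  ∣⊥∣<∣p∣ rewrite ∣⊥∣≡0 n | ∣p∣≡1+k = s≤s z≤n

p⊆q∧∣q∣≤∣p∣⇒p≡q : ∀ {p q : Subset n} → p ⊆ q → ∣ q ∣ ≤ ∣ p ∣ → p ≡ q
p⊆q∧∣q∣≤∣p∣⇒p≡q {p = p} {q} p⊆q ∣q∣≤∣p∣ = ⊆-antisym p⊆q q⊆p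
  where
  q⊆p : q ⊆ p
  q⊆p {x} x∈q = decidable-stable (x ∈? p)
    (λ x∉p → <⇒≱ (p⊂q⇒∣p∣<∣q∣ (p⊆q , x , x∈q , x∉p)) ∣q∣≤∣p∣)

p⊆q∧x∉p⇒p≡q-x : ∀ {p q : Subset n} {x} → p ⊆ q → x ∈ₛ q → x ∉ₛ p → ∣ q ∣ ≡ suc ∣ p ∣ → p ≡ q - x
p⊆q∧x∉p⇒p≡q-x {p = p} {q} {x} p⊆q x∈q x∉p ∣q∣≡1+∣p∣ =
  p⊆q∧∣q∣≤∣p∣⇒p≡q p⊆q-x (≤-reflexive (∣p∣≡1+k⇒∣p-x∣≡k x∈q ∣q∣≡1+∣p∣))
  where
  p⊆q-x : p ⊆ q - x
  p⊆q-x y∈p = x∈p∧x≢y⇒x∈p-y (p⊆q y∈p) (λ { refl → x∉p y∈p })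

-- When x ∈ p lies outside q, the trace p ∩ q sits inside p - x; a large enough trace fills it.
∣p∩q∣≥∣p-x∣⇒p-x⊆q : ∀ {p q : Subset n} {x} → ∣ p ∣ ≡ suc k → x ∈ₛ p → x ∉ₛ q → k ≤ ∣ p ∩ q ∣ → p - x ⊆ q
∣p∩q∣≥∣p-x∣⇒p-x⊆q {k = k} {p = p} {q} {x} ∣p∣≡1+k x∈p x∉q k≤∣p∩q∣ y∈p-x =
  p∩q⊆q p q (subst (_ ∈ₛ_) (sym p∩q≡p-x) y∈p-x)
  where
  p∩q⊆p-x : p ∩ q ⊆ p - x
  p∩q⊆p-x {y} y∈p∩q with x∈p∩q⁻ p q y∈p∩q
  ... | y∈p , y∈q = x∈p∧x≢y⇒x∈p-y y∈p (λ { refl → x∉q y∈q })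
  p∩q≡p-x : p ∩ q ≡ p - x
  p∩q≡p-x = p⊆q∧∣q∣≤∣p∣⇒p≡q p∩q⊆p-x (subst (_≤ ∣ p ∩ q ∣) (sym (∣p∣≡1+k⇒∣p-x∣≡k x∈p ∣p∣≡1+k)) k≤∣p∩q∣)

module _ {H : Hypergraph n} where

  avoiding-edge : ∀ {x} → ¬ IsCover H ⁅ x ⁆ → ∃ λ f → f ∈ edges H × x ∉ₛ f
  avoiding-edge {x} ¬cover with Any.any? (λ f → ¬? (x ∈? f)) (edges H)
  ... | yes avoided = find avoided
  ... | no none = ⊥-elim (¬cover cover)
    where
    cover : IsCover H ⁅ x ⁆
    cover e∈ = x , x∈p∩q⁺ (x∈⁅x⁆ x , decidable-stable (x ∈? _) (none ∘ lose e∈))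

  some-edge : ¬ IsCover H ⊥ → ∃ λ e → e ∈ edges H
  some-edge ¬cover with edges H
  ... | [] = ⊥-elim (¬cover λ ())
  ... | e ∷ _ = e , here refl

CompleteOn : ℕ → Hypergraph n → Subset n → Set
CompleteOn r H S = ∀ e → (e ∈ edges H) ⇔ (e ⊆ S × ∣ e ∣ ≡ r)

DeletionsAreEdges : Hypergraph n → Subset n → Set
DeletionsAreEdges H S = ∀ {v} → v ∈ₛ S → S - v ∈ edges H

module _ {H : Hypergraph n} (uniform : Uniform 3 H) (twoIntersecting : TwoIntersecting H) where

  x∈e∧x∉f⇒e-x⊆f : ∀ {e f x} → e ∈ edges H → f ∈ edges H → x ∈ₛ e → x ∉ₛ f → e - x ⊆ f
  x∈e∧x∉f⇒e-x⊆f e∈ f∈ x∈e x∉f =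
    ∣p∩q∣≥∣p-x∣⇒p-x⊆q (uniform e∈) x∈e x∉f (twoIntersecting e∈ f∈ λ { refl → x∉f x∈e })

  deletionsAreEdges⇒completeOn : ∀ {S} → ∣ S ∣ ≡ 4 → DeletionsAreEdges H S → CompleteOn 3 H S
  deletionsAreEdges⇒completeOn {S} ∣S∣≡4 S-v∈edges g = mk⇔ edge⇒triple triple⇒edge
    where
    edge⇒triple : g ∈ edges H → g ⊆ S × ∣ g ∣ ≡ 3
    edge⇒triple g∈ = g⊆S , uniform g∈
      where
      g⊆S : g ⊆ S
      g⊆S {x} x∈g = decidable-stable (x ∈? S) λ x∉S →
        let y , y∈g-x = ∣p∣≡1+k⇒nonempty (∣p∣≡1+k⇒∣p-x∣≡k x∈g (uniform g∈))
            y∈S-v : ∀ {v} → v ∈ₛ S → y ∈ₛ S - v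
            y∈S-v v∈S = x∈e∧x∉f⇒e-x⊆f g∈ (S-v∈edges v∈S) x∈g (x∉S ∘ x∈p-y⇒x∈p) y∈g-x
            v , v∈S = ∣p∣≡1+k⇒nonempty ∣S∣≡4
        in x∈p-y⇒x≢y (y∈S-v (x∈p-y⇒x∈p (y∈S-v v∈S))) refl
    triple⇒edge : g ⊆ S × ∣ g ∣ ≡ 3 → g ∈ edges H
    triple⇒edge (g⊆S , ∣g∣≡3) =
      let v , v∈S , v∉g = ∣q∣<∣p∣⇒∃∈p∉q ∣g∣<∣S∣
          g≡S-v = p⊆q∧x∉p⇒p≡q-x g⊆S v∈S v∉g (trans ∣S∣≡4 (cong suc (sym ∣g∣≡3)))
      in subst (_∈ edges H) (sym g≡S-v) (S-v∈edges v∈S)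
      where
      ∣g∣<∣S∣ : ∣ g ∣ < ∣ S ∣
      ∣g∣<∣S∣ rewrite ∣g∣≡3 | ∣S∣≡4 = ≤-refl

  ∃quadrupleWithDeletionsAsEdges : (∀ x → ∃ λ f → f ∈ edges H × x ∉ₛ f) → ∀ {e} → e ∈ edges H
    → ∃ λ S → ∣ S ∣ ≡ 4 × DeletionsAreEdges H S
  ∃quadrupleWithDeletionsAsEdges avoid {e} e∈ with ∣p∣≡1+k⇒nonempty (uniform e∈)
  ... | a , a∈e with avoid a
  ... | f , f∈ , a∉f = S , ∣S∣≡4 , deletions
    where
    S : Subset _
    S = f ∪ ⁅ a ⁆
    ∣S∣≡4 : ∣ S ∣ ≡ 4
    ∣S∣≡4 = trans (∣p∪⁅x⁆∣≡1+∣p∣ a∉f) (cong suc (uniform f∈))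
    through-a⊆S : ∀ {g} → g ∈ edges H → a ∈ₛ g → g ⊆ S
    through-a⊆S g∈ a∈g {w} w∈g with w ≟ a
    ... | yes refl = x∈p∪q⁺ (inj₂ (x∈⁅x⁆ a))
    ... | no w≢a = x∈p∪q⁺ (inj₁ (x∈e∧x∉f⇒e-x⊆f g∈ f∈ a∈g a∉f (x∈p∧x≢y⇒x∈p-y w∈g w≢a)))
    avoided-inside-S : ∀ v → ∃ λ g → g ∈ edges H × g ⊆ S × v ∉ₛ g
    avoided-inside-S v with v ≟ a | v ∈? e
    ... | yes refl | _ = f , f∈ , p⊆p∪q ⁅ a ⁆ , a∉f
    ... | no _ | no v∉e = e , e∈ , through-a⊆S e∈ a∈e , v∉e
    ... | no v≢a | yes v∈e with avoid v
    ...   | f′ , f′∈ , v∉f′ = f′ , f′∈ , through-a⊆S f′∈ a∈f′ , v∉f′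
      where
      a∈f′ : a ∈ₛ f′
      a∈f′ = x∈e∧x∉f⇒e-x⊆f e∈ f′∈ v∈e v∉f′ (x∈p∧x≢y⇒x∈p-y a∈e (v≢a ∘ sym))
    deletions : DeletionsAreEdges H S
    deletions {v} v∈S with avoided-inside-S v
    ... | g , g∈ , g⊆S , v∉g =
      subst (_∈ edges H) (p⊆q∧x∉p⇒p≡q-x g⊆S v∈S v∉g (trans ∣S∣≡4 (cong suc (sym (uniform g∈))))) g∈

mainTheorem13 : (n : ℕ) (H : Hypergraph n) → Uniform 3 H → TwoIntersecting H → CoveringNumberIs H 2
    → Σ (Subset n) (λ S → ∣ S ∣ ≡ 4 × (∀ e → (e ∈ edges H) ⇔ (e ⊆ S × ∣ e ∣ ≡ 3)))
mainTheorem13 n H uniform twoIntersecting (_ , minimal) =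
  let e , e∈ = some-edge (small-noncover ∣⊥∣<2)
      S , ∣S∣≡4 , deletions = ∃quadrupleWithDeletionsAsEdges uniform twoIntersecting
        (λ x → avoiding-edge (small-noncover (∣⁅x⁆∣<2 x))) e∈
  in S , ∣S∣≡4 , deletionsAreEdges⇒completeOn uniform twoIntersecting ∣S∣≡4 deletions
  where
  small-noncover : ∀ {C} → ∣ C ∣ < 2 → ¬ IsCover H C
  small-noncover {C} ∣C∣<2 cover = <⇒≱ ∣C∣<2 (minimal C cover)
  ∣⊥∣<2 : ∣ ⊥ {n} ∣ < 2
  ∣⊥∣<2 rewrite ∣⊥∣≡0 n = s≤s z≤n
  ∣⁅x⁆∣<2 : ∀ x → ∣ ⁅ x ⁆ ∣ < 2
  ∣⁅x⁆∣<2 x rewrite ∣⁅x⁆∣≡1 x = ≤-refl
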